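{- For all $n\ge 5$, $\overline{q}_n(123,132,321)=0$.
   Context: For a positive integer $n$, let $\mathcal{S}_{n,n}$ denote the set of all permutations (words) $\pi=\pi_1\cdots\pi_{2n}$ of the multiset $\{1,1,2,2,\ldots,n,n\}$. A word $\pi$ contains a pattern $\sigma=\sigma_1\cdots\sigma_k$ if there are indices $i_1<\cdots<i_k$ such that $\pi_{i_a}=\pi_{i_b}$ iff $\sigma_a=\sigma_b$ and $\pi_{i_a}<\pi_{i_b}$ iff $\sigma_a<\sigma_b$ for all $a,b$; otherwise $\pi$ avoids $\sigma$. The quasi-Stirling permutations $\overline{\mathcal{Q}}_n$ are the $\pi\in\mathcal{S}_{n,n}$ avoiding both $1212$ and $2121$. For a set $\Lambda$ of patterns, $\overline{\mathcal{Q}}_n(\Lambda)$ is the set of $\pi\in\overline{\mathcal{Q}}_n$ avoiding every pattern in $\Lambda$, and $\overline{q}_n(\Lambda)=|\overline{\mathcal{Q}}_n(\Lambda)|$. -}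

module Defs where

open import Data.Nat using (ℕ; zero; suc; _<_)
open import Data.List using (List; []; _∷_; _++_; length; lookup)
open import Data.List.Relation.Binary.Sublist.Propositional using (_⊆_)
open import Data.List.Relation.Binary.Permutation.Propositional using (_↭_)
open import Data.Fin using (Fin; cast)
open import Data.Product using (Σ; _×_; ∃)
open import Relation.Binary.PropositionalEquality using (_≡_)
open import Relation.Nullary using (¬_)
open import Function.Bundles using (_⇔_)

doubled : ℕ → List ℕ
doubled zero = []
doubled (suc n) = doubled n ++ (suc n ∷ suc n ∷ [])

InSnn : ℕ → List ℕ → Set
InSnn n π = π ↭ doubled n

OrderIso : (τ σ : List ℕ) → length τ ≡ length σ → Set
OrderIso τ σ eq =
  (a b : Fin (length τ)) →
    ((lookup τ a ≡ lookup τ b) ⇔ (lookup σ (cast eq a) ≡ lookup σ (cast eq b)))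
    × ((lookup τ a < lookup τ b) ⇔ (lookup σ (cast eq a) < lookup σ (cast eq b)))

Contains : (π σ : List ℕ) → Set
Contains π σ = Σ (List ℕ) λ τ → (τ ⊆ π) × Σ (length τ ≡ length σ) λ eq → OrderIso τ σ eq

Avoids : (π σ : List ℕ) → Set
Avoids π σ = ¬ Contains π σ

p1212 p2121 p123 p132 p321 : List ℕ
p1212 = 1 ∷ 2 ∷ 1 ∷ 2 ∷ []
p2121 = 2 ∷ 1 ∷ 2 ∷ 1 ∷ []
p123 = 1 ∷ 2 ∷ 3 ∷ []
p132 = 1 ∷ 3 ∷ 2 ∷ []
p321 = 3 ∷ 2 ∷ 1 ∷ []

QuasiStirling : ℕ → List ℕ → Set
QuasiStirling n π = InSnn n π × Avoids π p1212 × Avoids π p2121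

InQbar-123-132-321 : ℕ → List ℕ → Set
InQbar-123-132-321 n π = QuasiStirling n π × Avoids π p123 × Avoids π p132 × Avoids π p321

-- Only two facts about π are needed: it takes at least five distinct values,
-- and it avoids 123 and 321.  By the Erdős–Szekeres theorem any five distinct
-- values, read in order of first occurrence, contain an increasing or a
-- decreasing subsequence of length three, i.e. an occurrence of 123 or 321.
module Submission where

open import Defs
open import Data.Nat using (ℕ; _≤_)
open import Data.List using (List)
open import Relation.Nullary using (¬_)

open import Data.Nat using (zero; suc; _<_; z≤n; s≤s)
open import Data.Nat.Properties
  using (<-cmp; <-irrefl; <-asym; <-trans; n<1+n; _≟_; _≤?_; ≰⇒>; ≤-trans; ≤∧≢⇒<; ≤-pred; suc-injective)
open import Data.List using ([]; _∷_; length; lookup; deduplicate)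
open import Data.List.Membership.Propositional using (_∈_)
open import Data.List.Membership.Propositional.Properties using (∈-++⁺ˡ; ∈-++⁺ʳ; deduplicate-∈⇔)
open import Data.List.Relation.Binary.Sublist.Propositional using (_⊆_; []; _∷_; _∷ʳ_; ⊆-trans; minimum)
open import Data.List.Relation.Binary.Sublist.Propositional.Properties using (filter-⊆)
open import Data.List.Relation.Binary.Permutation.Propositional using (↭-sym)
open import Data.List.Relation.Binary.Permutation.Propositional.Properties using (∈-resp-↭)
open import Data.List.Relation.Unary.Any using (here; index)
open import Data.List.Relation.Unary.Any.Properties using (lookup-index)
open import Data.List.Relation.Unary.All using (_∷_)
open import Data.List.Relation.Unary.AllPairs using (_∷_)
open import Data.List.Relation.Unary.Unique.Propositional using (Unique)
open import Data.List.Relation.Unary.Unique.DecPropositional.Properties using (deduplicate-!)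
open import Data.Fin using (Fin; toℕ) renaming (zero to fzero; suc to fsuc)
open import Data.Fin.Properties using (pigeonhole; toℕ-injective; toℕ<n) renaming (<-irrefl to <-irreflᶠ)
open import Data.Product using (_×_; _,_)
open import Data.Sum using (_⊎_; inj₁; inj₂; [_,_]; swap; map)
open import Data.Empty using (⊥-elim)
open import Function using (_∘_; flip; Injective)
open import Function.Bundles using (_⇔_; mk⇔; Equivalence)
open import Relation.Binary using (DecidableEquality; Trichotomous; tri<; tri≈; tri>)
import Relation.Binary.Construct.Flip.EqAndOrd as Flip
open import Relation.Binary.PropositionalEquality using (_≡_; refl; sym; trans; cong; _≢_)
open import Relation.Nullary using (¬?; yes; no)

data Chain₃ {A : Set} (_≺_ : A → A → Set) (xs : List A) : Set where
  chain : ∀ {x y z} → x ≺ y → y ≺ z → (x ∷ y ∷ z ∷ []) ⊆ xs → Chain₃ _≺_ xs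

MonotoneChain₃ : {A : Set} → (A → A → Set) → List A → Set
MonotoneChain₃ _≺_ xs = Chain₃ _≺_ xs ⊎ Chain₃ (flip _≺_) xs

Chain₃-⊆ : {A : Set} {_≺_ : A → A → Set} {xs ys : List A} → xs ⊆ ys → Chain₃ _≺_ xs → Chain₃ _≺_ ys
Chain₃-⊆ xs⊆ys (chain x≺y y≺z sub) = chain x≺y y≺z (⊆-trans sub xs⊆ys)

MonotoneChain₃-⊆ : {A : Set} {_≺_ : A → A → Set} {xs ys : List A} →
  xs ⊆ ys → MonotoneChain₃ _≺_ xs → MonotoneChain₃ _≺_ ys
MonotoneChain₃-⊆ xs⊆ys = map (Chain₃-⊆ xs⊆ys) (Chain₃-⊆ xs⊆ys)

module ErdősSzekeres {A : Set} {_≺_ : A → A → Set} (compare : Trichotomous _≡_ _≺_) where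

  private
    order : ∀ {x y} → x ≢ y → x ≺ y ⊎ y ≺ x
    order {x} {y} x≢y with compare x y
    ... | tri< x≺y _ _ = inj₁ x≺y
    ... | tri≈ _ x≡y _ = ⊥-elim (x≢y x≡y)
    ... | tri> _ _ y≺x = inj₂ y≺x

  monotoneChain₃-after-ascent : ∀ {a b c d e xs} → a ≺ b →
    b ≢ c → b ≢ d → c ≢ d → b ≢ e → d ≢ e → MonotoneChain₃ _≺_ (a ∷ b ∷ c ∷ d ∷ e ∷ xs)
  monotoneChain₃-after-ascent {a} {b} {c} {d} {e} {xs} a≺b b≢c b≢d c≢d b≢e d≢e
    with order b≢c
  ... | inj₁ b≺c = inj₁ (chain a≺b b≺c (refl ∷ refl ∷ refl ∷ d ∷ʳ e ∷ʳ minimum xs))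
  ... | inj₂ c≺b with order b≢d
  ...   | inj₁ b≺d = inj₁ (chain a≺b b≺d (refl ∷ refl ∷ c ∷ʳ refl ∷ e ∷ʳ minimum xs))
  ...   | inj₂ d≺b with order c≢d
  ...     | inj₂ d≺c = inj₂ (chain c≺b d≺c (a ∷ʳ refl ∷ refl ∷ refl ∷ e ∷ʳ minimum xs))
  ...     | inj₁ c≺d with order b≢e
  ...       | inj₁ b≺e = inj₁ (chain a≺b b≺e (refl ∷ refl ∷ c ∷ʳ d ∷ʳ refl ∷ minimum xs))
  ...       | inj₂ e≺b with order d≢e
  ...         | inj₁ d≺e = inj₁ (chain c≺d d≺e (a ∷ʳ b ∷ʳ refl ∷ refl ∷ refl ∷ minimum xs))
  ...         | inj₂ e≺d = inj₂ (chain d≺b e≺d (a ∷ʳ refl ∷ c ∷ʳ refl ∷ refl ∷ minimum xs))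

monotoneChain₃ : {A : Set} {_≺_ : A → A → Set} → Trichotomous _≡_ _≺_ →
  ∀ {xs} → Unique xs → 5 ≤ length xs → MonotoneChain₃ _≺_ xs
monotoneChain₃ compare {a ∷ b ∷ c ∷ d ∷ e ∷ _}
  ((a≢b ∷ _) ∷ (b≢c ∷ b≢d ∷ b≢e ∷ _) ∷ (c≢d ∷ _) ∷ (d≢e ∷ _) ∷ _) (s≤s (s≤s (s≤s (s≤s (s≤s _)))))
  with compare a b
... | tri< a≺b _ _ = ErdősSzekeres.monotoneChain₃-after-ascent compare a≺b b≢c b≢d c≢d b≢e d≢e
... | tri≈ _ a≡b _ = ⊥-elim (a≢b a≡b)
... | tri> _ _ b≺a =
  -- in the reversed order b ≻ a is an ascent, and the two kinds of chain trade places
  swap (ErdősSzekeres.monotoneChain₃-after-ascent (Flip.compare _ compare) b≺a b≢c b≢d c≢d b≢e d≢e)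

data SameOrder : ℕ → ℕ → ℕ → ℕ → Set where
  both< : ∀ {u v p q} → u < v → p < q → SameOrder u v p q
  both≡ : ∀ {u p} → SameOrder u u p p
  both> : ∀ {u v p q} → v < u → q < p → SameOrder u v p q

SameOrder-sym : ∀ {u v p q} → SameOrder u v p q → SameOrder v u q p
SameOrder-sym (both< u<v p<q) = both> u<v p<q
SameOrder-sym both≡ = both≡
SameOrder-sym (both> v<u q<p) = both< v<u q<p

SameOrder⇒comparisons-agree : ∀ {u v p q} → SameOrder u v p q →
  ((u ≡ v) ⇔ (p ≡ q)) × ((u < v) ⇔ (p < q))
SameOrder⇒comparisons-agree (both< u<v p<q) =
  mk⇔ (λ { refl → ⊥-elim (<-irrefl refl u<v) }) (λ { refl → ⊥-elim (<-irrefl refl p<q) }) ,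
  mk⇔ (λ _ → p<q) (λ _ → u<v)
SameOrder⇒comparisons-agree both≡ =
  mk⇔ (λ _ → refl) (λ _ → refl) ,
  mk⇔ (λ u<u → ⊥-elim (<-irrefl refl u<u)) (λ p<p → ⊥-elim (<-irrefl refl p<p))
SameOrder⇒comparisons-agree (both> v<u q<p) =
  mk⇔ (λ { refl → ⊥-elim (<-irrefl refl v<u) }) (λ { refl → ⊥-elim (<-irrefl refl q<p) }) ,
  mk⇔ (λ u<v → ⊥-elim (<-asym u<v v<u)) (λ p<q → ⊥-elim (<-asym p<q q<p))

orderIso₃ : ∀ {x y z p q r} → SameOrder x y p q → SameOrder y z q r → SameOrder x z p r →
  OrderIso (x ∷ y ∷ z ∷ []) (p ∷ q ∷ r ∷ []) refl
orderIso₃ xy yz xz fzero               fzero               = SameOrder⇒comparisons-agree both≡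
orderIso₃ xy yz xz fzero               (fsuc fzero)        = SameOrder⇒comparisons-agree xy
orderIso₃ xy yz xz fzero               (fsuc (fsuc fzero)) = SameOrder⇒comparisons-agree xz
orderIso₃ xy yz xz (fsuc fzero)        fzero               = SameOrder⇒comparisons-agree (SameOrder-sym xy)
orderIso₃ xy yz xz (fsuc fzero)        (fsuc fzero)        = SameOrder⇒comparisons-agree both≡
orderIso₃ xy yz xz (fsuc fzero)        (fsuc (fsuc fzero)) = SameOrder⇒comparisons-agree yz
orderIso₃ xy yz xz (fsuc (fsuc fzero)) fzero               = SameOrder⇒comparisons-agree (SameOrder-sym xz)
orderIso₃ xy yz xz (fsuc (fsuc fzero)) (fsuc fzero)        = SameOrder⇒comparisons-agree (SameOrder-sym yz)
orderIso₃ xy yz xz (fsuc (fsuc fzero)) (fsuc (fsuc fzero)) = SameOrder⇒comparisons-agree both≡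

1<2 : 1 < 2
1<2 = n<1+n 1

2<3 : 2 < 3
2<3 = n<1+n 2

ascending⇒contains-123 : ∀ {π} → Chain₃ _<_ π → Contains π p123
ascending⇒contains-123 (chain x<y y<z sub) =
  _ , sub , refl , orderIso₃ (both< x<y 1<2) (both< y<z 2<3) (both< (<-trans x<y y<z) (<-trans 1<2 2<3))

descending⇒contains-321 : ∀ {π} → Chain₃ (flip _<_) π → Contains π p321
descending⇒contains-321 (chain y<x z<y sub) =
  _ , sub , refl , orderIso₃ (both> y<x 2<3) (both> z<y 1<2) (both> (<-trans z<y y<x) (<-trans 1<2 2<3))

length-≥-#distinct-members : ∀ {A : Set} {k} (f : Fin k → A) → Injective _≡_ _≡_ f →
  ∀ {xs} → (∀ i → f i ∈ xs) → k ≤ length xs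
length-≥-#distinct-members {k = k} f f-injective {xs} f∈xs with k ≤? length xs
... | yes k≤∣xs∣ = k≤∣xs∣
... | no k≰∣xs∣ with pigeonhole (≰⇒> k≰∣xs∣) (index ∘ f∈xs)
...   | i , j , i<j , same-index = ⊥-elim (<-irreflᶠ (f-injective fi≡fj) i<j)
  where
  fi≡fj : f i ≡ f j
  fi≡fj = trans (lookup-index (f∈xs i)) (trans (cong (lookup xs) same-index) (sym (lookup-index (f∈xs j))))

deduplicate-⊆ : {A : Set} (_≟ᴬ_ : DecidableEquality A) (xs : List A) → deduplicate _≟ᴬ_ xs ⊆ xs
deduplicate-⊆ _≟ᴬ_ [] = []
deduplicate-⊆ _≟ᴬ_ (x ∷ xs) = refl ∷ ⊆-trans (filter-⊆ (¬? ∘ (x ≟ᴬ_)) _) (deduplicate-⊆ _≟ᴬ_ xs)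

∈-doubled : ∀ {k} n → 1 ≤ k → k ≤ n → k ∈ doubled n
∈-doubled {suc _} zero _ ()
∈-doubled {k} (suc n) 1≤k k≤1+n with k ≟ suc n
... | yes refl = ∈-++⁺ʳ (doubled n) (here refl)
... | no k≢1+n = ∈-++⁺ˡ (∈-doubled n 1≤k (≤-pred (≤∧≢⇒< k≤1+n k≢1+n)))

∈-InSnn : ∀ {n π k} → InSnn n π → 1 ≤ k → k ≤ n → k ∈ π
∈-InSnn {n} π↭doubled 1≤k k≤n = ∈-resp-↭ (↭-sym π↭doubled) (∈-doubled n 1≤k k≤n)

theorem4p8 : (n : ℕ) → 5 ≤ n → (π : List ℕ) → ¬ InQbar-123-132-321 n π
theorem4p8 n 5≤n π ((π∈Snn , _ , _) , avoids123 , _ , avoids321) =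
  [ avoids123 ∘ ascending⇒contains-123 , avoids321 ∘ descending⇒contains-321 ]
    (MonotoneChain₃-⊆ (deduplicate-⊆ _≟_ π) (monotoneChain₃ <-cmp (deduplicate-! _≟_ π) five≤#values))
  where
  value : Fin 5 → ℕ
  value = suc ∘ toℕ

  value-injective : Injective _≡_ _≡_ value
  value-injective = toℕ-injective ∘ suc-injective

  value∈values : ∀ i → value i ∈ deduplicate _≟_ π
  value∈values i = Equivalence.to (deduplicate-∈⇔ _≟_) (∈-InSnn π∈Snn (s≤s z≤n) (≤-trans (toℕ<n i) 5≤n))

  five≤#values : 5 ≤ length (deduplicate _≟_ π)
  five≤#values = length-≥-#distinct-members value value-injective value∈values
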